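{- Let $p$ and $l$ be positive integers with $p\leq\sqrt{l}$ and let $k=(\log l)/2$. Let $F$ be a family of $2^p$ words $x^1,\dots,x^{2^p}$ of length $l$, chosen uniformly and independently at random from $\{0,1\}^l$. Then the probability that $F$ fails Property (P1) is at most $2^{ -\Omega(\sqrt{l}\log\log l)}$ (as $l\to\infty$).
   Context: Logarithms are in base $2$. For words $u,x$, $\mathrm{occ}_x(u)$ is the number of occurrences of $u$ as a factor (contiguous substring) of $x$. Property (P1) for $F$: for every $x\in F$ and every binary word $u$ with $|u|\leq k$, $\mathrm{occ}_x(u)\leq \frac{kl}{2^{|u|}}$. -}

module Defs where

open import Data.Bool using (Bool; true; false; _∧_; _∨_; not; if_then_else_)
open import Data.Nat using (ℕ; zero; suc; _+_; _*_; _^_; _≤ᵇ_; _≤_)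
open import Data.Nat.Logarithm using (⌊log₂_⌋)
open import Data.List using (List; []; _∷_; length; concatMap; map; filter; upTo; _++_)
open import Data.Bool using (T)
open import Relation.Nullary.Decidable using (Dec; yes; no)

Word : Set
Word = List Bool

allWords : ℕ → List Word
allWords zero    = [] ∷ []
allWords (suc n) = map (false ∷_) (allWords n) ++ map (true ∷_) (allWords n)

tuples : {A : Set} → ℕ → List A → List (List A)
tuples zero    xs = [] ∷ []
tuples (suc m) xs = concatMap (λ x → map (x ∷_) (tuples m xs)) xs

allB : {A : Set} → (A → Bool) → List A → Bool
allB f []       = true
allB f (x ∷ xs) = f x ∧ allB f xs

isPrefix : Word → Word → Bool
isPrefix []      _        = true
isPrefix (_ ∷ _) []       = false
isPrefix (a ∷ u) (b ∷ x)  = (if a then b else not b) ∧ isPrefix u x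

-- occ u x : number of occurrences of u as a factor of x
-- (positions i = 0..|x| such that u occurs starting at i)
occ : Word → Word → ℕ
occ u []       = if isPrefix u [] then 1 else 0
occ u (b ∷ x)  = (if isPrefix u (b ∷ x) then 1 else 0) + occ u x

-- Property (P1) with k = (log₂ l)/2, decided exactly over ℕ:
--   |u| ≤ k            ⇔  2^(2|u|) = 4^|u| ≤ l
--   occ ≤ k l / 2^|u|  ⇔  2·2^|u|·occ ≤ l·log₂ l  ⇔  2^(2·2^|u|·occ) ≤ l^l
-- Words u with |u| ≤ k have |u| ≤ l, so lengths 0..l are enumerated.
P1word : ℕ → Word → Bool
P1word l x =
  allB (λ n → not (4 ^ n ≤ᵇ l)
             ∨ allB (λ u → 2 ^ (2 * 2 ^ n * occ u x) ≤ᵇ l ^ l) (allWords n))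
      (upTo (suc l))

P1 : ℕ → List Word → Bool
P1 l F = allB (P1word l) F

failCount : ℕ → ℕ → ℕ
failCount m l = length (filter (λ F → T? (not (P1 l F))) (tuples m (allWords l)))
  where
  T? : (b : Bool) → Dec (T b)
  T? true  = yes _
  T? false = no (λ ())

module Submission where

-- Everything is counted exactly over ℕ: W n enumerates {0,1}^n, and a
-- probability bound Pr ≤ 2^(-X) is the inequality  count · 2^X ≤ 2^(#samples).
--
-- Fix a pattern u of length N ≥ 1.  Occurrences of u in x split according to
-- the residue c < N of their starting position modulo N; occurrences in one
-- residue class sit in disjoint aligned blocks of length N and so behave like
-- independent trials of success probability 2^(-N).  The exponential moment
-- Σ_x t^(aligned count) therefore factorises over the blocks and is at most
-- 2^l · (1 + t/2^N)^K for K blocks.  Markov's inequality bounds the number of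
-- x with ≥ r aligned occurrences in a class, and pigeonhole reduces
-- "occ u x ≥ N·r" to "some class has ≥ r".  Tuning t = 2^J, r and K (using
-- (1 + 1/M)^M ≤ 4) leaves, for every pattern admitted by (P1), at most
-- N · 2^l · 2^(-X) bad words, with X ≈ √l · log log l.  Union bounds over the
-- ≤ l+1 lengths, the patterns of each length and the 2^p members of the family
-- finish the proof, with a = 1, b = 8 and L₀ = 2^(2^27).

open import Defs
open import Data.Bool using (Bool; true; false; _∧_; _∨_; not; if_then_else_; T)
open import Data.Unit using (tt)
open import Data.Nat
open import Data.Nat.Properties
open import Data.Nat.DivMod using (_/_; _%_; m≡m%n+[m/n]*n; m%n<n)
open import Data.Nat.Logarithm
open import Data.Product using (_,_; ∃; ∃₂; _×_; ∃-syntax)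
open import Data.List using (List; []; _∷_; length; map; _++_; concatMap; filter; upTo)
open import Data.List.Properties using (length-++; length-map; length-upTo)
open import Data.List.Relation.Unary.All as All using (All; []; _∷_)
open import Data.List.Relation.Unary.All.Properties using (++⁺; map⁺)
open import Relation.Binary.PropositionalEquality hiding (J)
open import Relation.Nullary using (Dec; yes; no)
open import Data.Empty using (⊥-elim)
open import Function using (_∘_)
open import Data.Nat.Solver using (module +-*-Solver)
open +-*-Solver

ind : Bool → ℕ
ind b = if b then 1 else 0

ind≤1 : ∀ b → ind b ≤ 1
ind≤1 true  = ≤-refl
ind≤1 false = z≤n

sumL : {A : Set} → (A → ℕ) → List A → ℕ
sumL f []       = 0
sumL f (x ∷ xs) = f x + sumL f xs

module _ {A : Set} where
  sumL-++ : ∀ (f : A → ℕ) xs ys → sumL f (xs ++ ys) ≡ sumL f xs + sumL f ys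
  sumL-++ f []       ys = refl
  sumL-++ f (x ∷ xs) ys = trans (cong (f x +_) (sumL-++ f xs ys)) (sym (+-assoc (f x) _ _))

  sumL-mono : ∀ {f g : A → ℕ} xs → (∀ x → f x ≤ g x) → sumL f xs ≤ sumL g xs
  sumL-mono []       h = z≤n
  sumL-mono (x ∷ xs) h = +-mono-≤ (h x) (sumL-mono xs h)

  sumL-monoᴬ : ∀ {f g : A → ℕ} {xs} → All (λ x → f x ≤ g x) xs → sumL f xs ≤ sumL g xs
  sumL-monoᴬ []       = z≤n
  sumL-monoᴬ (p ∷ ps) = +-mono-≤ p (sumL-monoᴬ ps)

  sumL-cong : ∀ {f g : A → ℕ} xs → (∀ x → f x ≡ g x) → sumL f xs ≡ sumL g xs
  sumL-cong []       h = refl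
  sumL-cong (x ∷ xs) h = cong₂ _+_ (h x) (sumL-cong xs h)

  sumL-congᴬ : ∀ {f g : A → ℕ} {xs} → All (λ x → f x ≡ g x) xs → sumL f xs ≡ sumL g xs
  sumL-congᴬ []       = refl
  sumL-congᴬ (p ∷ ps) = cong₂ _+_ p (sumL-congᴬ ps)

  sumL-+ : ∀ (f g : A → ℕ) xs → sumL (λ x → f x + g x) xs ≡ sumL f xs + sumL g xs
  sumL-+ f g []       = refl
  sumL-+ f g (x ∷ xs) = trans (cong (f x + g x +_) (sumL-+ f g xs))
    (solve 4 (λ a b c d → a :+ b :+ (c :+ d) := a :+ c :+ (b :+ d)) refl (f x) (g x) (sumL f xs) (sumL g xs))

  sumL-*ˡ : ∀ c (f : A → ℕ) xs → sumL (λ x → c * f x) xs ≡ c * sumL f xs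
  sumL-*ˡ c f []       = sym (*-zeroʳ c)
  sumL-*ˡ c f (x ∷ xs) = trans (cong (c * f x +_) (sumL-*ˡ c f xs)) (sym (*-distribˡ-+ c (f x) _))

  sumL-*ʳ : ∀ c (f : A → ℕ) xs → sumL (λ x → f x * c) xs ≡ sumL f xs * c
  sumL-*ʳ c f xs = trans (sumL-cong xs (λ x → *-comm (f x) c)) (trans (sumL-*ˡ c f xs) (*-comm c _))

  sumL-const : ∀ c (xs : List A) → sumL (λ _ → c) xs ≡ length xs * c
  sumL-const c []       = refl
  sumL-const c (x ∷ xs) = cong (c +_) (sumL-const c xs)

  sumL-zero : ∀ (xs : List A) → sumL (λ _ → 0) xs ≡ 0
  sumL-zero xs = trans (sumL-const 0 xs) (*-zeroʳ (length xs))

  sumL-bound : ∀ {f : A → ℕ} c xs → (∀ x → f x ≤ c) → sumL f xs ≤ length xs * c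
  sumL-bound c xs h = subst (_ ≤_) (sumL-const c xs) (sumL-mono xs h)

  sumL-boundᴬ : ∀ {f : A → ℕ} c {xs} → All (λ x → f x ≤ c) xs → sumL f xs ≤ length xs * c
  sumL-boundᴬ c {xs} h = subst (_ ≤_) (sumL-const c xs) (sumL-monoᴬ h)

sumL-map : ∀ {A B : Set} (f : B → ℕ) (g : A → B) xs → sumL f (map g xs) ≡ sumL (f ∘ g) xs
sumL-map f g []       = refl
sumL-map f g (x ∷ xs) = cong (f (g x) +_) (sumL-map f g xs)

sumL-swap : ∀ {A B : Set} (f : A → B → ℕ) xs ys →
  sumL (λ x → sumL (f x) ys) xs ≡ sumL (λ y → sumL (λ x → f x y) xs) ys
sumL-swap f []       ys = sym (sumL-zero ys)
sumL-swap f (x ∷ xs) ys =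
  trans (cong (sumL (f x) ys +_) (sumL-swap f xs ys)) (sym (sumL-+ (f x) _ ys))

sumL-concatMap : ∀ {A B : Set} (g : B → ℕ) (h : A → List B) xs →
  sumL g (concatMap h xs) ≡ sumL (λ x → sumL g (h x)) xs
sumL-concatMap g h []       = refl
sumL-concatMap g h (x ∷ xs) =
  trans (sumL-++ g (h x) (concatMap h xs)) (cong (sumL g (h x) +_) (sumL-concatMap g h xs))

length-filter : ∀ {A : Set} (f : A → Bool) (d : (x : A) → Dec (T (f x))) xs →
  length (filter d xs) ≡ sumL (ind ∘ f) xs
length-filter f d [] = refl
length-filter f d (x ∷ xs) with f x | d x
... | true  | yes _ = cong suc (length-filter f d xs)
... | true  | no ¬p = ⊥-elim (¬p _)
... | false | no _  = length-filter f d xs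

sumBelow : ℕ → (ℕ → ℕ) → ℕ
sumBelow zero    f = 0
sumBelow (suc k) f = f 0 + sumBelow k (f ∘ suc)

sumBelow-suc : ∀ k f → sumBelow (suc k) f ≡ sumBelow k f + f k
sumBelow-suc zero    f = +-comm (f 0) 0
sumBelow-suc (suc k) f = trans (cong (f 0 +_) (sumBelow-suc k (f ∘ suc))) (sym (+-assoc (f 0) _ _))

sumBelow-term : ∀ k f c → c < k → f c ≤ sumBelow k f
sumBelow-term (suc k) f zero    _         = m≤m+n (f 0) _
sumBelow-term (suc k) f (suc c) (s≤s c<k) = ≤-trans (sumBelow-term k (f ∘ suc) c c<k) (m≤n+m _ (f 0))

sumL-sumBelow : ∀ {A : Set} k (g : ℕ → A → ℕ) xs →
  sumL (λ x → sumBelow k (λ c → g c x)) xs ≡ sumBelow k (λ c → sumL (g c) xs)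
sumL-sumBelow zero    g xs = sumL-zero xs
sumL-sumBelow (suc k) g xs = trans (sumL-+ (g 0) _ xs) (cong (sumL (g 0) xs +_) (sumL-sumBelow k (g ∘ suc) xs))

sumBelow-bound : ∀ k (g : ℕ → ℕ) X Y → (∀ c → c < k → g c * X ≤ Y) → sumBelow k g * X ≤ k * Y
sumBelow-bound zero    g X Y h = z≤n
sumBelow-bound (suc k) g X Y h = ≤-trans (≤-reflexive (*-distribʳ-+ X (g 0) _))
  (+-mono-≤ (h 0 z<s) (sumBelow-bound k (g ∘ suc) X Y (λ c c<k → h (suc c) (s<s c<k))))

pigeonhole : ∀ k f r → suc k * r ≤ sumBelow (suc k) f → ∃ λ c → c < suc k × r ≤ f c
pigeonhole k f r le with r ≤? f 0
... | yes r≤f0 = 0 , z<s , r≤f0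
pigeonhole zero    f r le | no r≰f0 =
  ⊥-elim (r≰f0 (subst₂ _≤_ (+-identityʳ r) (+-identityʳ (f 0)) le))
pigeonhole (suc k) f r le | no r≰f0 with pigeonhole k (f ∘ suc) r
  (+-cancelˡ-≤ r _ _ (≤-trans le (+-monoˡ-≤ _ (<⇒≤ (≰⇒> r≰f0)))))
... | c , c<k , r≤fc = suc c , s<s c<k , r≤fc

W : ℕ → List Word
W = allWords

length-W : ∀ n → length (W n) ≡ 2 ^ n
length-W zero    = refl
length-W (suc n) = begin
  length (map (false ∷_) (W n) ++ map (true ∷_) (W n))
    ≡⟨ length-++ (map (false ∷_) (W n)) ⟩
  length (map (false ∷_) (W n)) + length (map (true ∷_) (W n))
    ≡⟨ cong₂ _+_ (length-map _ (W n)) (length-map _ (W n)) ⟩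
  length (W n) + length (W n)
    ≡⟨ cong₂ _+_ (length-W n) (trans (length-W n) (sym (+-identityʳ _))) ⟩
  2 ^ suc n ∎
  where open ≡-Reasoning

W-length : ∀ n → All (λ u → length u ≡ n) (W n)
W-length zero    = refl ∷ []
W-length (suc n) = ++⁺ (map⁺ (All.map (cong suc) (W-length n))) (map⁺ (All.map (cong suc) (W-length n)))

sumW-1 : ∀ n → sumL (λ _ → 1) (W n) ≡ 2 ^ n
sumW-1 n = trans (sumL-const 1 (W n)) (trans (*-identityʳ _) (length-W n))

sumW-suc : ∀ (f : Word → ℕ) n → sumL f (W (suc n)) ≡ sumL (f ∘ (false ∷_)) (W n) + sumL (f ∘ (true ∷_)) (W n)
sumW-suc f n = trans (sumL-++ f (map (false ∷_) (W n)) _) (cong₂ _+_ (sumL-map f _ (W n)) (sumL-map f _ (W n)))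

sumW-split : ∀ (f : Word → ℕ) a b →
  sumL f (W (a + b)) ≡ sumL (λ y → sumL (λ z → f (y ++ z)) (W b)) (W a)
sumW-split f zero    b = sym (+-identityʳ _)
sumW-split f (suc a) b = begin
  sumL f (W (suc a + b))
    ≡⟨ sumW-suc f (a + b) ⟩
  sumL (f ∘ (false ∷_)) (W (a + b)) + sumL (f ∘ (true ∷_)) (W (a + b))
    ≡⟨ cong₂ _+_ (sumW-split (f ∘ (false ∷_)) a b) (sumW-split (f ∘ (true ∷_)) a b) ⟩
  sumL (G ∘ (false ∷_)) (W a) + sumL (G ∘ (true ∷_)) (W a)
    ≡⟨ sym (sumW-suc G a) ⟩
  sumL G (W (suc a)) ∎
  where
  open ≡-Reasoning
  G : Word → ℕ
  G y = sumL (λ z → f (y ++ z)) (W b)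

-- The exponential moment of the event "y begins with u" for uniform y of
-- length |u|: Σ_y t^[u ≼ y] = (2^n - 1) + t ≤ 2^n + t.
prefixMoment : ∀ t n u → length u ≡ n → sumL (λ y → t ^ ind (isPrefix u y)) (W n) ≤ 2 ^ n + t
prefixMoment t zero    []      _ = ≤-trans (≤-reflexive (trans (+-identityʳ (t * 1)) (*-identityʳ t))) (m≤n+m t 1)
prefixMoment t (suc n) (a ∷ u) e = begin
  sumL F (W (suc n))
    ≡⟨ sumW-suc F n ⟩
  sumL (F ∘ (false ∷_)) (W n) + sumL (F ∘ (true ∷_)) (W n)
    ≤⟨ halves a ⟩
  2 ^ n + (2 ^ n + t)
    ≡⟨ solve 2 (λ m t → m :+ (m :+ t) := con 2 :* m :+ t) refl (2 ^ n) t ⟩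
  2 ^ suc n + t ∎
  where
  open ≤-Reasoning
  F : Word → ℕ
  F y = t ^ ind (isPrefix (a ∷ u) y)
  hit  = prefixMoment t n u (suc-injective e)
  miss = ≤-reflexive (sumW-1 n)
  -- words starting with the wrong letter contribute t^0 = 1 each
  halves : ∀ a → sumL (λ y → t ^ ind (isPrefix (a ∷ u) (false ∷ y))) (W n)
               + sumL (λ y → t ^ ind (isPrefix (a ∷ u) (true ∷ y))) (W n) ≤ 2 ^ n + (2 ^ n + t)
  halves true  = +-mono-≤ miss hit
  halves false = ≤-trans (≤-reflexive (+-comm _ (sumL (λ _ → 1) (W n)))) (+-mono-≤ miss hit)

isPrefix-++ : ∀ u y z → length u ≡ length y → isPrefix u (y ++ z) ≡ isPrefix u y
isPrefix-++ []      y       z e = refl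
isPrefix-++ (a ∷ u) (b ∷ y) z e = cong (_ ∧_) (isPrefix-++ u y z (suc-injective e))

isPrefix-short : ∀ u y → length y < length u → isPrefix u y ≡ false
isPrefix-short (a ∷ u) []      _         = refl
isPrefix-short (a ∷ u) (b ∷ y) (s≤s lt) rewrite isPrefix-short u y lt with a | b
... | true  | true  = refl
... | true  | false = refl
... | false | true  = refl
... | false | false = refl

-- aligned u d φ x counts the occurrences of u in x starting at the positions
-- φ, φ + (d+1), φ + 2(d+1), … .  For |u| = d+1 these occurrences lie in
-- disjoint aligned blocks, which is what makes them independent.
aligned : Word → ℕ → ℕ → Word → ℕ
aligned u d φ       []      = 0
aligned u d zero    (b ∷ x) = ind (isPrefix u (b ∷ x)) + aligned u d d x
aligned u d (suc φ) (b ∷ x) = aligned u d φ x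

occ-aligned : ∀ a u d x → occ (a ∷ u) x ≡ sumBelow (suc d) (λ c → aligned (a ∷ u) d c x)
occ-aligned a u d []      = sym (none d)
  where
  none : ∀ k → sumBelow k (λ c → aligned (a ∷ u) d c []) ≡ 0
  none zero    = refl
  none (suc k) = none k
occ-aligned a u d (b ∷ x) = begin
  ind (isPrefix v (b ∷ x)) + occ v x
    ≡⟨ cong (ind (isPrefix v (b ∷ x)) +_) (trans (occ-aligned a u d x) (sumBelow-suc d (λ c → aligned v d c x))) ⟩
  ind (isPrefix v (b ∷ x)) + (sumBelow d (λ c → aligned v d c x) + aligned v d d x)
    ≡⟨ solve 3 (λ i s t → i :+ (s :+ t) := i :+ t :+ s) refl (ind (isPrefix v (b ∷ x))) _ (aligned v d d x) ⟩
  sumBelow (suc d) (λ c → aligned v d c (b ∷ x)) ∎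
  where
  open ≡-Reasoning
  v = a ∷ u

aligned-skip : ∀ u d φ y z → length y ≡ φ → aligned u d φ (y ++ z) ≡ aligned u d 0 z
aligned-skip u d zero    []      z e = refl
aligned-skip u d (suc φ) (b ∷ y) z e = aligned-skip u d φ y z (suc-injective e)

aligned-block : ∀ u d y z → length u ≡ suc d → length y ≡ suc d →
  aligned u d 0 (y ++ z) ≡ ind (isPrefix u y) + aligned u d 0 z
aligned-block u d (b ∷ y) z eu ey =
  cong₂ _+_ (cong ind (isPrefix-++ u (b ∷ y) z (trans eu (sym ey)))) (aligned-skip u d d y z (suc-injective ey))

aligned-short : ∀ u d → length u ≡ suc d → ∀ φ x → length x < φ + suc d → aligned u d φ x ≡ 0
aligned-short u d eu φ       []      lt = refl
aligned-short u d eu zero    (b ∷ x) lt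
  rewrite isPrefix-short u (b ∷ x) (subst (length (b ∷ x) <_) (sym eu) lt) =
  aligned-short u d eu d x (≤-trans (≤-pred lt) (m≤m+n d _))
aligned-short u d eu (suc φ) (b ∷ x) lt = aligned-short u d eu φ x (≤-pred lt)

moment : ℕ → Word → ℕ → ℕ → ℕ → ℕ
moment t u d c m = sumL (λ x → t ^ aligned u d c x) (W m)

moment-block : ∀ t u d m → length u ≡ suc d →
  moment t u d 0 (suc d + m) ≡ sumL (λ y → t ^ ind (isPrefix u y)) (W (suc d)) * moment t u d 0 m
moment-block t u d m eu = begin
  moment t u d 0 (suc d + m)
    ≡⟨ sumW-split _ (suc d) m ⟩
  sumL (λ y → sumL (λ z → t ^ aligned u d 0 (y ++ z)) (W m)) (W (suc d))
    ≡⟨ sumL-congᴬ (All.map (λ {y} ey → sumL-cong (W m) (λ z → block y z ey)) (W-length (suc d))) ⟩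
  sumL (λ y → sumL (λ z → t ^ ind (isPrefix u y) * t ^ aligned u d 0 z) (W m)) (W (suc d))
    ≡⟨ sumL-cong (W (suc d)) (λ y → sumL-*ˡ (t ^ ind (isPrefix u y)) _ (W m)) ⟩
  sumL (λ y → t ^ ind (isPrefix u y) * moment t u d 0 m) (W (suc d))
    ≡⟨ sumL-*ʳ (moment t u d 0 m) _ (W (suc d)) ⟩
  sumL (λ y → t ^ ind (isPrefix u y)) (W (suc d)) * moment t u d 0 m ∎
  where
  open ≡-Reasoning
  block : ∀ y z → length y ≡ suc d →
    t ^ aligned u d 0 (y ++ z) ≡ t ^ ind (isPrefix u y) * t ^ aligned u d 0 z
  block y z ey = trans (cong (t ^_) (aligned-block u d y z eu ey)) (^-distribˡ-+-* t (ind (isPrefix u y)) _)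

moment-short : ∀ t u d m → length u ≡ suc d → m < suc d → moment t u d 0 m ≡ 2 ^ m
moment-short t u d m eu lt = trans
  (sumL-congᴬ (All.map (λ {x} ex → cong (t ^_) (aligned-short u d eu 0 x (subst (_< suc d) (sym ex) lt))) (W-length m)))
  (sumW-1 m)

moment₀-bound : ∀ t u d → length u ≡ suc d → ∀ K m → m ≤ K * suc d →
  moment t u d 0 m * (2 ^ suc d) ^ K ≤ 2 ^ m * (2 ^ suc d + t) ^ K
moment₀-bound t u d eu zero    .zero z≤n = ≤-refl
moment₀-bound t u d eu (suc K) m   m≤  with m <? suc d
... | yes lt rewrite moment-short t u d m eu lt = *-monoʳ-≤ (2 ^ m) (^-monoˡ-≤ (suc K) (m≤m+n P t))
  where P = 2 ^ suc d
... | no ¬lt with m≤n⇒∃[o]m+o≡n (≮⇒≥ ¬lt)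
... | m' , refl = begin
  moment t u d 0 (suc d + m') * (P * P ^ K)
    ≡⟨ cong (_* (P * P ^ K)) (moment-block t u d m' eu) ⟩
  A * B * (P * P ^ K)
    ≡⟨ solve 4 (λ A B P PK → A :* B :* (P :* PK) := A :* (B :* PK) :* P) refl A B P (P ^ K) ⟩
  A * (B * P ^ K) * P
    ≤⟨ *-monoˡ-≤ P (*-mono-≤ (prefixMoment t (suc d) u eu) (moment₀-bound t u d eu K m' m'≤)) ⟩
  Q * (2 ^ m' * Q ^ K) * P
    ≡⟨ solve 4 (λ Q M QK P → Q :* (M :* QK) :* P := P :* M :* (Q :* QK)) refl Q (2 ^ m') (Q ^ K) P ⟩
  P * 2 ^ m' * (Q * Q ^ K)
    ≡⟨ cong (_* (Q * Q ^ K)) (sym (^-distribˡ-+-* 2 (suc d) m')) ⟩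
  2 ^ (suc d + m') * (Q * Q ^ K) ∎
  where
  open ≤-Reasoning
  P = 2 ^ suc d
  Q = 2 ^ suc d + t
  A = sumL (λ y → t ^ ind (isPrefix u y)) (W (suc d))
  B = moment t u d 0 m'
  m'≤ : m' ≤ K * suc d
  m'≤ = +-cancelˡ-≤ (suc d) m' (K * suc d) m≤

moment-skip : ∀ t u d c m → moment t u d c (c + m) ≡ 2 ^ c * moment t u d 0 m
moment-skip t u d c m = begin
  moment t u d c (c + m)
    ≡⟨ sumW-split _ c m ⟩
  sumL (λ y → sumL (λ z → t ^ aligned u d c (y ++ z)) (W m)) (W c)
    ≡⟨ sumL-congᴬ (All.map (λ {y} ey → sumL-cong (W m) (λ z → cong (t ^_) (aligned-skip u d c y z ey))) (W-length c)) ⟩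
  sumL (λ _ → moment t u d 0 m) (W c)
    ≡⟨ trans (sumL-const _ (W c)) (cong (_* moment t u d 0 m) (length-W c)) ⟩
  2 ^ c * moment t u d 0 m ∎
  where open ≡-Reasoning

moment-bound : ∀ t u d → length u ≡ suc d → ∀ K c m → c ≤ m → m ≤ K * suc d →
  moment t u d c m * (2 ^ suc d) ^ K ≤ 2 ^ m * (2 ^ suc d + t) ^ K
moment-bound t u d eu K c m c≤m m≤ with m≤n⇒∃[o]m+o≡n c≤m
... | m' , refl = begin
  moment t u d c (c + m') * P ^ K
    ≡⟨ cong (_* P ^ K) (moment-skip t u d c m') ⟩
  2 ^ c * moment t u d 0 m' * P ^ K
    ≡⟨ *-assoc (2 ^ c) _ _ ⟩
  2 ^ c * (moment t u d 0 m' * P ^ K)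
    ≤⟨ *-monoʳ-≤ (2 ^ c) (moment₀-bound t u d eu K m' (≤-trans (m≤n+m m' c) m≤)) ⟩
  2 ^ c * (2 ^ m' * Q ^ K)
    ≡⟨ trans (sym (*-assoc (2 ^ c) _ _)) (cong (_* Q ^ K) (sym (^-distribˡ-+-* 2 c m'))) ⟩
  2 ^ (c + m') * Q ^ K ∎
  where
  open ≤-Reasoning
  P = 2 ^ suc d
  Q = 2 ^ suc d + t

≤ᵇ-true : ∀ {m n} → (m ≤ᵇ n) ≡ true → m ≤ n
≤ᵇ-true {m} {n} e = ≤ᵇ⇒≤ m n (subst T (sym e) tt)

≤ᵇ-false : ∀ {m n} → (m ≤ᵇ n) ≡ false → n < m
≤ᵇ-false e = ≰⇒> (λ m≤n → subst T e (≤⇒≤ᵇ m≤n))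

ind-T : ∀ {b} → T b → ind b ≡ 1
ind-T {true} _ = refl

markov : ∀ {A : Set} s .{{_ : NonZero s}} r (f : A → ℕ) xs →
  sumL (λ x → ind (r ≤ᵇ f x)) xs * s ^ r ≤ sumL (λ x → s ^ f x) xs
markov s r f xs = ≤-trans (≤-reflexive (sym (sumL-*ʳ (s ^ r) _ xs))) (sumL-mono xs pointwise)
  where
  pointwise : ∀ x → ind (r ≤ᵇ f x) * s ^ r ≤ s ^ f x
  pointwise x with r ≤ᵇ f x in e
  ... | true  = ≤-trans (≤-reflexive (+-identityʳ _)) (^-monoʳ-≤ s (≤ᵇ-true {r} {f x} e))
  ... | false = z≤n

pigeonhole-ind : ∀ k f r → ind (suc k * r ≤ᵇ sumBelow (suc k) f) ≤ sumBelow (suc k) (λ c → ind (r ≤ᵇ f c))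
pigeonhole-ind k f r with suc k * r ≤ᵇ sumBelow (suc k) f in e
... | false = z≤n
... | true with pigeonhole k f r (≤ᵇ-true e)
... | c , c<k , r≤fc = ≤-trans (≤-reflexive (sym (ind-T (≤⇒≤ᵇ r≤fc)))) (sumBelow-term (suc k) (λ c → ind (r ≤ᵇ f c)) c c<k)

-- violates l n u x: x breaks the (P1) bound for the pattern u of length n
-- (literally the test performed by P1word).
violates : ℕ → ℕ → Word → Word → ℕ
violates l n u x = ind (not (2 ^ (2 * 2 ^ n * occ u x) ≤ᵇ l ^ l))

badWords : ℕ → ℕ → Word → ℕ
badWords l n u = sumL (violates l n u) (W l)

^2-cancel-< : ∀ a b → 2 ^ a < 2 ^ b → a < b
^2-cancel-< a b lt = ≰⇒> (λ b≤a → <⇒≱ lt (^-monoʳ-≤ 2 b≤a))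

violation⇒manyOcc : ∀ l L N r u x → 2 ^ (l * L) ≤ l ^ l → N * r * (2 * 2 ^ N) ≤ l * L →
  violates l N u x ≤ ind (N * r ≤ᵇ occ u x)
violation⇒manyOcc l L N r u x hl hr with 2 ^ (2 * 2 ^ N * occ u x) ≤ᵇ l ^ l in e
... | true  = z≤n
... | false = ≤-reflexive (sym (ind-T (≤⇒≤ᵇ (<⇒≤ few<occ))))
  where
  lL<occ : l * L < 2 * 2 ^ N * occ u x
  lL<occ = ^2-cancel-< _ _ (≤-<-trans hl (≤ᵇ-false e))
  few<occ : N * r < occ u x
  few<occ = *-cancelʳ-< (2 * 2 ^ N) _ _
    (≤-<-trans hr (subst (l * L <_) (*-comm (2 * 2 ^ N) (occ u x)) lL<occ))

badWords≤classes : ∀ l L r a u' → let u = a ∷ u' ; d = length u' in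
  2 ^ (l * L) ≤ l ^ l → suc d * r * (2 * 2 ^ suc d) ≤ l * L →
  badWords l (suc d) u ≤ sumBelow (suc d) (λ c → sumL (λ x → ind (r ≤ᵇ aligned u d c x)) (W l))
badWords≤classes l L r a u' hl hr = ≤-trans (sumL-mono (W l) perWord)
  (≤-reflexive (sumL-sumBelow (suc d) (λ c x → ind (r ≤ᵇ aligned u d c x)) (W l)))
  where
  u = a ∷ u'
  d = length u'
  perWord : ∀ x → violates l (suc d) u x ≤ sumBelow (suc d) (λ c → ind (r ≤ᵇ aligned u d c x))
  perWord x = ≤-trans (violation⇒manyOcc l L (suc d) r u x hl hr)
    (subst (λ o → ind (suc d * r ≤ᵇ o) ≤ sumBelow (suc d) (λ c → ind (r ≤ᵇ aligned u d c x))) (sym (occ-aligned a u' d x)) (pigeonhole-ind d (λ c → aligned u d c x) r))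

badWords-moment : ∀ l L t .{{_ : NonZero t}} r K a u' → let N = suc (length u') in
  2 ^ (l * L) ≤ l ^ l → N * r * (2 * 2 ^ N) ≤ l * L → N ≤ l → l ≤ K * N →
  badWords l N (a ∷ u') * (t ^ r * (2 ^ N) ^ K) ≤ N * (2 ^ l * (2 ^ N + t) ^ K)
badWords-moment l L t r K a u' hl hr N≤l l≤KN =
  ≤-trans (*-monoˡ-≤ (t ^ r * P ^ K) (badWords≤classes l L r a u' hl hr))
          (sumBelow-bound N count (t ^ r * P ^ K) (2 ^ l * (P + t) ^ K) perClass)
  where
  u = a ∷ u'
  d = length u'
  N = suc d
  P = 2 ^ N
  count : ℕ → ℕ
  count c = sumL (λ x → ind (r ≤ᵇ aligned u d c x)) (W l)
  perClass : ∀ c → c < N → count c * (t ^ r * P ^ K) ≤ 2 ^ l * (P + t) ^ K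
  perClass c c<N = begin
    count c * (t ^ r * P ^ K)  ≡⟨ *-assoc (count c) _ _ ⟨
    count c * t ^ r * P ^ K    ≤⟨ *-monoˡ-≤ (P ^ K) (markov t r (aligned u d c) (W l)) ⟩
    moment t u d c l * P ^ K   ≤⟨ moment-bound t u d refl K c l (≤-trans (<⇒≤ c<N) N≤l) l≤KN ⟩
    2 ^ l * (P + t) ^ K        ∎
    where open ≤-Reasoning

^-distrib-* : ∀ a b n → (a * b) ^ n ≡ a ^ n * b ^ n
^-distrib-* a b zero    = refl
^-distrib-* a b (suc n) = trans (cong (a * b *_) (^-distrib-* a b n))
  (solve 4 (λ a b x y → a :* b :* (x :* y) := a :* x :* (b :* y)) refl a b (a ^ n) (b ^ n))

-- A Bernoulli-type estimate (1 + 1/M)^ρ ≤ (M + 1)/(M + 1 - ρ), cleared of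
-- denominators: for ρ + d = M,  (M+1)^ρ · (d+1) ≤ M^ρ · (M+1).
bernoulli : ∀ M ρ d → ρ + d ≡ M → suc M ^ ρ * suc d ≤ M ^ ρ * suc M
bernoulli M zero    d refl = ≤-refl
bernoulli M (suc ρ) d e = begin
  suc M * suc M ^ ρ * suc d
    ≡⟨ solve 3 (λ A B C → A :* B :* C := B :* (A :* C)) refl (suc M) (suc M ^ ρ) (suc d) ⟩
  suc M ^ ρ * (suc M * suc d)
    ≤⟨ *-monoʳ-≤ (suc M ^ ρ) oneStep ⟩
  suc M ^ ρ * (M * suc (suc d))
    ≡⟨ solve 3 (λ A B C → A :* (B :* C) := B :* (A :* C)) refl (suc M ^ ρ) M (suc (suc d)) ⟩
  M * (suc M ^ ρ * suc (suc d))
    ≤⟨ *-monoʳ-≤ M (bernoulli M ρ (suc d) (trans (+-suc ρ d) e)) ⟩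
  M * (M ^ ρ * suc M)
    ≡⟨ *-assoc M (M ^ ρ) (suc M) ⟨
  M * M ^ ρ * suc M ∎
  where
  open ≤-Reasoning
  -- (M+1)(d+1) ≤ M(d+2) since M = ρ + 1 + d ≥ d + 1
  oneStep : suc M * suc d ≤ M * suc (suc d)
  oneStep rewrite sym e = ≤-trans (m≤m+n _ ρ) (≤-reflexive
    (solve 2 (λ ρ d → (con 1 :+ (con 1 :+ ρ :+ d)) :* (con 1 :+ d) :+ ρ
                   := (con 1 :+ ρ :+ d) :* (con 1 :+ (con 1 :+ d))) refl ρ d))

halfPower : ∀ M' → suc (2 * M') ^ M' ≤ 2 * (2 * M') ^ M'
halfPower M' = *-cancelʳ-≤ _ _ (suc M') (begin
  suc M ^ M' * suc M'
    ≤⟨ bernoulli M M' M' (cong (M' +_) (sym (+-identityʳ M'))) ⟩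
  M ^ M' * suc M
    ≤⟨ *-monoʳ-≤ (M ^ M') (≤-trans (m≤m+n (suc M) 1)
         (≤-reflexive (solve 1 (λ m → con 1 :+ con 2 :* m :+ con 1 := con 2 :* (con 1 :+ m)) refl M'))) ⟩
  M ^ M' * (2 * suc M')
    ≡⟨ solve 2 (λ A B → A :* (con 2 :* B) := con 2 :* A :* B) refl (M ^ M') (suc M') ⟩
  2 * M ^ M' * suc M' ∎)
  where
  open ≤-Reasoning
  M = 2 * M'

fullPower : ∀ M' → suc (2 * M') ^ (2 * M') ≤ 4 * (2 * M') ^ (2 * M')
fullPower M' = begin
  suc M ^ (2 * M')
    ≡⟨ cong (λ k → suc M ^ (M' + k)) (+-identityʳ M') ⟩
  suc M ^ (M' + M')
    ≡⟨ ^-distribˡ-+-* (suc M) M' M' ⟩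
  suc M ^ M' * suc M ^ M'
    ≤⟨ *-mono-≤ (halfPower M') (halfPower M') ⟩
  2 * M ^ M' * (2 * M ^ M')
    ≡⟨ solve 1 (λ A → con 2 :* A :* (con 2 :* A) := con 4 :* (A :* A)) refl (M ^ M') ⟩
  4 * (M ^ M' * M ^ M')
    ≡⟨ cong (4 *_) (trans (sym (^-distribˡ-+-* M M' M')) (cong (λ k → M ^ (M' + k)) (sym (+-identityʳ M')))) ⟩
  4 * M ^ (2 * M') ∎
  where
  open ≤-Reasoning
  M = 2 * M'

shiftedPower : ∀ A M' q → let M = 2 * M' in (A * M + A) ^ (M * q) ≤ 4 ^ q * (A * M) ^ (M * q)
shiftedPower A M' q = begin
  (A * M + A) ^ K
    ≡⟨ cong (_^ K) (solve 2 (λ A M → A :* M :+ A := A :* (con 1 :+ M)) refl A M) ⟩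
  (A * suc M) ^ K
    ≡⟨ trans (^-distrib-* A (suc M) K) (cong (A ^ K *_) (sym (^-*-assoc (suc M) M q))) ⟩
  A ^ K * (suc M ^ M) ^ q
    ≤⟨ *-monoʳ-≤ (A ^ K) (^-monoˡ-≤ q (fullPower M')) ⟩
  A ^ K * (4 * M ^ M) ^ q
    ≡⟨ cong (A ^ K *_) (trans (^-distrib-* 4 (M ^ M) q) (cong (4 ^ q *_) (^-*-assoc M M q))) ⟩
  A ^ K * (4 ^ q * M ^ K)
    ≡⟨ solve 3 (λ a b c → a :* (b :* c) := b :* (a :* c)) refl (A ^ K) (4 ^ q) (M ^ K) ⟩
  4 ^ q * (A ^ K * M ^ K)
    ≡⟨ cong (4 ^ q *_) (^-distrib-* A M K) ⟨
  4 ^ q * (A * M) ^ K ∎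
  where
  open ≤-Reasoning
  M = 2 * M'
  K = M * q

-- The tail bound for one pattern, with moment parameter S = 2^J, a length
-- N = J + e + 1 (so 2^N = 2^J · M with M = 2^(e+1)) and K = M·q blocks:
-- if X + 2q ≤ J·r then at most N · 2^l · 2^(-X) words violate (P1) for u.
badWords-tail : ∀ l L J e r q X a u' → let N = suc (length u') in
  J + suc e ≡ N → 2 ^ (l * L) ≤ l ^ l → N * r * (2 * 2 ^ N) ≤ l * L → N ≤ l →
  l ≤ 2 ^ suc e * q * N → X + 2 * q ≤ J * r →
  badWords l N (a ∷ u') * 2 ^ X ≤ N * 2 ^ l
badWords-tail l L J e r q X a u' eN hl hr N≤l l≤ hX = *-cancelʳ-≤ _ _ (4 ^ q) {{m^n≢0 4 q}} (begin
  C * 2 ^ X * 4 ^ q    ≡⟨ trans (*-assoc C _ _) (cong (C *_) twoPowers) ⟩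
  C * 2 ^ (X + 2 * q)  ≤⟨ *-monoʳ-≤ C (^-monoʳ-≤ 2 hX) ⟩
  C * 2 ^ (J * r)      ≡⟨ cong (C *_) (^-*-assoc 2 J r) ⟨
  C * S ^ r            ≤⟨ momentBound ⟩
  N * 2 ^ l * 4 ^ q    ∎)
  where
  open ≤-Reasoning
  N = suc (length u')
  M = 2 ^ suc e
  K = M * q
  S = 2 ^ J
  P = 2 ^ N
  C = badWords l N (a ∷ u')
  twoPowers : 2 ^ X * 4 ^ q ≡ 2 ^ (X + 2 * q)
  twoPowers = trans (cong (2 ^ X *_) (^-*-assoc 2 2 q)) (sym (^-distribˡ-+-* 2 X (2 * q)))
  P≡TM : P ≡ S * M
  P≡TM = trans (cong (2 ^_) (sym eN)) (^-distribˡ-+-* 2 J (suc e))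
  shifted : (P + S) ^ K ≤ 4 ^ q * P ^ K
  shifted = subst (λ z → (z + S) ^ K ≤ 4 ^ q * z ^ K) (sym P≡TM) (shiftedPower S (2 ^ e) q)
  momentBound : C * S ^ r ≤ N * 2 ^ l * 4 ^ q
  momentBound = *-cancelʳ-≤ _ _ (P ^ K) {{m^n≢0 P K {{m^n≢0 2 N}}}} (begin
    C * S ^ r * P ^ K              ≡⟨ *-assoc C _ _ ⟩
    C * (S ^ r * P ^ K)            ≤⟨ badWords-moment l L S {{m^n≢0 2 J}} r K a u' hl hr N≤l l≤ ⟩
    N * (2 ^ l * (P + S) ^ K)      ≤⟨ *-monoʳ-≤ N (*-monoʳ-≤ (2 ^ l) shifted) ⟩
    N * (2 ^ l * (4 ^ q * P ^ K))  ≡⟨ solve 4 (λ a b c d → a :* (b :* (c :* d)) := a :* b :* c :* d) refl N (2 ^ l) (4 ^ q) (P ^ K) ⟩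
    N * 2 ^ l * 4 ^ q * P ^ K      ∎)

euclid : ∀ x D → 0 < D → ∃₂ λ r ρ → x ≡ ρ + r * D × ρ < D
euclid x (suc D) _ = x / suc D , x % suc D , m≡m%n+[m/n]*n x (suc D) , m%n<n x (suc D)

scaled-quotient : ∀ y j x r ρ D → 1 ≤ j → x ≡ ρ + r * D → ρ < D → (y + j) * D ≤ j * x → y ≤ j * r
scaled-quotient y j x r ρ D j≥1 ex ρ<D h = <⇒≤ (+-cancelʳ-< j y (j * r)
  (subst (y + j <_) (+-comm j (j * r)) (*-cancelʳ-< D _ _ (begin-strict
    (y + j) * D          ≤⟨ h ⟩
    j * x                ≡⟨ trans (cong (j *_) ex) (*-distribˡ-+ j ρ (r * D)) ⟩
    j * ρ + j * (r * D)  <⟨ +-monoˡ-< (j * (r * D)) (*-monoʳ-< j {{>-nonZero j≥1}} ρ<D) ⟩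
    j * D + j * (r * D)  ≡⟨ solve 3 (λ j d r → j :* d :+ j :* (r :* d) := (j :+ j :* r) :* d) refl j D r ⟩
    (j + j * r) * D      ∎))))
  where open ≤-Reasoning

tuning-budget : ∀ l L J M N w X q₀ → 2 ^ N ≡ 2 ^ J * M →
  1 ≤ J → 8 * 2 ^ J ≤ L → 2 * N ≤ L → w * 2 ^ N ≤ l → 2 * (X + J + 2) ≤ w * J → q₀ * (M * N) ≤ l →
  (X + 2 * suc q₀ + J) * (N * (2 * 2 ^ N)) ≤ J * (l * L)
tuning-budget l L J M N w X q₀ eP J≥1 hJL hNL hw hX hq₀ = *-cancelʳ-≤ _ _ 2 (begin
  (X + 2 * suc q₀ + J) * D * 2
    ≡⟨ solve 4 (λ x y j d → (x :+ y :+ j) :* d :* con 2 := ((x :+ j) :* d :+ y :* d) :* con 2) refl X (2 * suc q₀) J D ⟩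
  ((X + J) * D + 2 * suc q₀ * D) * 2
    ≤⟨ *-monoˡ-≤ 2 (+-monoʳ-≤ ((X + J) * D) blocksCost) ⟩
  ((X + J) * D + (4 * PJ * l + 2 * D)) * 2
    ≡⟨ solve 5 (λ x j d p l → ((x :+ j) :* d :+ (con 4 :* p :* l :+ con 2 :* d)) :* con 2
                         := (x :+ j :+ con 2) :* d :* con 2 :+ con 4 :* p :* l :* con 2) refl X J D PJ l ⟩
  (X + J + 2) * D * 2 + 4 * PJ * l * 2
    ≤⟨ +-mono-≤ exponentCost momentCost ⟩
  J * L * l + J * L * l
    ≡⟨ solve 3 (λ j L l → j :* L :* l :+ j :* L :* l := j :* (l :* L) :* con 2) refl J L l ⟩
  J * (l * L) * 2 ∎)
  where
  open ≤-Reasoning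
  D = N * (2 * 2 ^ N)
  PJ = 2 ^ J
  blocksCost : 2 * suc q₀ * D ≤ 4 * PJ * l + 2 * D
  blocksCost = begin
    2 * suc q₀ * D                   ≡⟨ cong (λ p → 2 * suc q₀ * (N * (2 * p))) eP ⟩
    2 * suc q₀ * (N * (2 * (PJ * M))) ≡⟨ solve 4 (λ q n p m → con 2 :* (con 1 :+ q) :* (n :* (con 2 :* (p :* m)))
                                          := con 4 :* p :* (q :* (m :* n)) :+ con 2 :* (n :* (con 2 :* (p :* m)))) refl q₀ N PJ M ⟩
    4 * PJ * (q₀ * (M * N)) + 2 * (N * (2 * (PJ * M))) ≤⟨ +-mono-≤ (*-monoʳ-≤ (4 * PJ) hq₀) (≤-reflexive (cong (λ p → 2 * (N * (2 * p))) (sym eP))) ⟩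
    4 * PJ * l + 2 * D               ∎
  exponentCost : (X + J + 2) * D * 2 ≤ J * L * l
  exponentCost = begin
    (X + J + 2) * D * 2
      ≡⟨ solve 4 (λ y n p j → y :* (n :* (con 2 :* p)) :* con 2 := con 2 :* y :* (con 2 :* n) :* p) refl (X + J + 2) N (2 ^ N) J ⟩
    2 * (X + J + 2) * (2 * N) * 2 ^ N
      ≤⟨ *-monoˡ-≤ (2 ^ N) (*-mono-≤ hX hNL) ⟩
    w * J * L * 2 ^ N
      ≡⟨ solve 4 (λ w j l p → w :* j :* l :* p := j :* l :* (w :* p)) refl w J L (2 ^ N) ⟩
    J * L * (w * 2 ^ N)
      ≤⟨ *-monoʳ-≤ (J * L) hw ⟩
    J * L * l ∎
  momentCost : 4 * PJ * l * 2 ≤ J * L * l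
  momentCost = begin
    4 * PJ * l * 2  ≡⟨ solve 2 (λ p l → con 4 :* p :* l :* con 2 := con 8 :* p :* l) refl PJ l ⟩
    8 * PJ * l      ≤⟨ *-monoˡ-≤ l (≤-trans hJL (m≤n*m L J {{>-nonZero J≥1}})) ⟩
    J * L * l       ∎

-- Choice of r = ⌊l·L / D⌋ occurrences per class and of q = ⌊l/(M·N)⌋ + 1
-- groups of M blocks, meeting all side conditions of badWords-tail.
tuning : ∀ l L J e N w X → let M = 2 ^ suc e in J + suc e ≡ N →
  1 ≤ J → 8 * 2 ^ J ≤ L → 2 * N ≤ L → w * 2 ^ N ≤ l → 2 * (X + J + 2) ≤ w * J →
  ∃₂ λ r q → N * r * (2 * 2 ^ N) ≤ l * L × l ≤ M * q * N × X + 2 * q ≤ J * r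
tuning l L J e N w X eN J≥1 hJL hNL hw hX
  with euclid (l * L) (N * (2 * 2 ^ N)) (*-mono-< N>0 (*-monoʳ-< 2 (m^n>0 2 N)))
     | euclid l (2 ^ suc e * N) (*-mono-< (m^n>0 2 (suc e)) N>0)
  where
  N>0 : 0 < N
  N>0 = ≤-trans z<s (≤-trans (m≤n+m (suc e) J) (≤-reflexive eN))
... | r , ρ , elL , ρ< | q₀ , σ , el , σ< = r , suc q₀ , rFits , lCovered , budget
  where
  M = 2 ^ suc e
  D = N * (2 * 2 ^ N)
  rFits : N * r * (2 * 2 ^ N) ≤ l * L
  rFits = ≤-trans (≤-reflexive (solve 3 (λ n r p → n :* r :* p := r :* (n :* p)) refl N r (2 * 2 ^ N)))
            (≤-trans (m≤n+m (r * D) ρ) (≤-reflexive (sym elL)))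
  lCovered : l ≤ M * suc q₀ * N
  lCovered = ≤-trans (≤-reflexive el) (≤-trans (+-monoˡ-≤ (q₀ * (M * N)) (<⇒≤ σ<))
    (≤-reflexive (solve 3 (λ m n q → m :* n :+ q :* (m :* n) := m :* (con 1 :+ q) :* n) refl M N q₀)))
  budget : X + 2 * suc q₀ ≤ J * r
  budget = scaled-quotient (X + 2 * suc q₀) J (l * L) r ρ D J≥1 elL ρ<
    (tuning-budget l L J M N w X q₀ (trans (cong (2 ^_) (sym eN)) (^-distribˡ-+-* 2 J (suc e))) J≥1 hJL hNL hw hX
      (≤-trans (m≤n+m (q₀ * (M * N)) σ) (≤-reflexive (sym el))))

n<2^n : ∀ n → n < 2 ^ n
n<2^n zero    = z<s
n<2^n (suc n) = ≤-trans (s≤s (n<2^n n)) (≤-trans (≤-reflexive (cong suc (sym (+-identityʳ (2 ^ n)))))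
                  (+-monoˡ-≤ (2 ^ n + 0) (m^n>0 2 n)))

sq-cancel-≤ : ∀ a b → a * a ≤ b * b → a ≤ b
sq-cancel-≤ a b h = ≮⇒≥ (λ b<a → <⇒≱ (*-mono-< b<a b<a) h)

sq-cancel-< : ∀ a b → a * a < b * b → a < b
sq-cancel-< a b h = ≰⇒> (λ b≤a → <⇒≱ h (*-mono-≤ b≤a b≤a))

-- A word of length l has l + 1 starting positions.
occ≤ : ∀ u x → occ u x ≤ suc (length x)
occ≤ u []      = ind≤1 (isPrefix u [])
occ≤ u (b ∷ x) = +-mono-≤ (ind≤1 (isPrefix u (b ∷ x))) (occ≤ u x)

badWords-zero : ∀ l n u → (∀ x → length x ≡ l → 2 ^ (2 * 2 ^ n * occ u x) ≤ l ^ l) → badWords l n u ≡ 0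
badWords-zero l n u h = trans (sumL-congᴬ (All.map (λ {x} ex → cong (λ b → ind (not b)) (fits x ex)) (W-length l)))
                              (sumL-zero (W l))
  where
  fits : ∀ x → length x ≡ l → (2 ^ (2 * 2 ^ n * occ u x) ≤ᵇ l ^ l) ≡ true
  fits x ex with 2 ^ (2 * 2 ^ n * occ u x) ≤ᵇ l ^ l in e
  ... | true  = refl
  ... | false = ⊥-elim (<⇒≱ (≤ᵇ-false e) (h x ex))

-- The numerical setting in which the tail bounds are applied: L ≈ log l,
-- J ≈ log log l, w ≈ √l, and the target exponent X with 2(X + J + 2) ≤ wJ.
record Params : Set where
  field
    l L J w X : ℕ
    l≥1 : 1 ≤ l
    J≥1 : 1 ≤ J
    hl  : 2 ^ (l * L) ≤ l ^ l
    hlL : l < 2 ^ suc L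
    hJL : 8 * 2 ^ J ≤ L
    hw  : w * w ≤ l
    hX  : 2 * (X + J + 2) ≤ w * J

module PerPattern (π : Params) where
  open Params π

  twoN≤L : ∀ N → 4 ^ N ≤ l → 2 * N ≤ L
  twoN≤L N h4 = ≮⇒≥ (λ L<2N → <⇒≱ hlL (≤-trans (^-monoʳ-≤ 2 L<2N) (≤-trans (≤-reflexive (sym (^-*-assoc 2 2 N))) h4)))

  w2^N≤l : ∀ N → 4 ^ N ≤ l → w * 2 ^ N ≤ l
  w2^N≤l N h4 = sq-cancel-≤ (w * 2 ^ N) l (begin
    w * 2 ^ N * (w * 2 ^ N) ≡⟨ solve 2 (λ w p → w :* p :* (w :* p) := w :* w :* (p :* p)) refl w (2 ^ N) ⟩
    w * w * (2 ^ N * 2 ^ N) ≡⟨ cong (w * w *_) (^-distrib-* 2 2 N) ⟨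
    w * w * 4 ^ N           ≤⟨ *-mono-≤ hw h4 ⟩
    l * l                   ∎)
    where open ≤-Reasoning

  N≤l : ∀ N → 4 ^ N ≤ l → N ≤ l
  N≤l N h4 = ≤-trans (<⇒≤ (n<2^n N)) (≤-trans (^-monoˡ-≤ N (s≤s (s≤s z≤n))) h4)

  J<N : ∀ N → L < 4 * 2 ^ N → J < N
  J<N N big = <⇒≤ (^2-cancel-< (suc J) N (*-cancelˡ-< 4 _ _ (begin-strict
    4 * 2 ^ suc J ≡⟨ solve 1 (λ p → con 4 :* (con 2 :* p) := con 8 :* p) refl (2 ^ J) ⟩
    8 * 2 ^ J     ≤⟨ hJL ⟩
    L             <⟨ big ⟩
    4 * 2 ^ N     ∎)))
    where open ≤-Reasoning

  -- Short patterns (4·2^N ≤ L) cannot violate (P1) at all: occ ≤ l + 1.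
  badWords-short : ∀ N u → 4 * 2 ^ N ≤ L → badWords l N u ≡ 0
  badWords-short N u small = badWords-zero l N u (λ x ex → ≤-trans (^-monoʳ-≤ 2 (fewOcc x ex)) hl)
    where
    fewOcc : ∀ x → length x ≡ l → 2 * 2 ^ N * occ u x ≤ l * L
    fewOcc x ex = begin
      2 * 2 ^ N * occ u x  ≤⟨ *-monoʳ-≤ (2 * 2 ^ N) (≤-trans (occ≤ u x) (≤-reflexive (cong suc ex))) ⟩
      2 * 2 ^ N * suc l    ≤⟨ *-monoʳ-≤ (2 * 2 ^ N) (+-monoˡ-≤ l l≥1) ⟩
      2 * 2 ^ N * (l + l)  ≡⟨ solve 2 (λ p l → con 2 :* p :* (l :+ l) := l :* (con 4 :* p)) refl (2 ^ N) l ⟩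
      l * (4 * 2 ^ N)      ≤⟨ *-monoʳ-≤ l small ⟩
      l * L                ∎
      where open ≤-Reasoning

  badWords-long : ∀ a u' → let N = suc (length u') in 4 ^ N ≤ l → L < 4 * 2 ^ N →
    badWords l N (a ∷ u') * 2 ^ X ≤ N * 2 ^ l
  badWords-long a u' h4 big = fromSplit (m≤n⇒∃[o]m+o≡n (J<N N big))
    where
    N = suc (length u')
    fromSplit : (∃ λ e → suc J + e ≡ N) → badWords l N (a ∷ u') * 2 ^ X ≤ N * 2 ^ l
    fromSplit (e , eJ) = fromTuning (tuning l L J e N w X eN J≥1 hJL (twoN≤L N h4) (w2^N≤l N h4) hX)
      where
      eN : J + suc e ≡ N
      eN = trans (+-suc J e) eJ
      fromTuning : (∃₂ λ r q → N * r * (2 * 2 ^ N) ≤ l * L × l ≤ 2 ^ suc e * q * N × X + 2 * q ≤ J * r) →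
        badWords l N (a ∷ u') * 2 ^ X ≤ N * 2 ^ l
      fromTuning (r , q , hr , hq , hx) = badWords-tail l L J e r q X a u' eN hl hr (N≤l N h4) hq hx

  badWords-bound : ∀ u → 4 ^ length u ≤ l → badWords l (length u) u * 2 ^ X ≤ length u * 2 ^ l
  badWords-bound u h4 with 4 * 2 ^ length u ≤? L
  badWords-bound u        h4 | yes small = ≤-trans (≤-reflexive (cong (_* 2 ^ X) (badWords-short (length u) u small))) z≤n
  badWords-bound []       h4 | no big    = ⊥-elim (n≮0 (J<N 0 (≰⇒> big)))
  badWords-bound (a ∷ u') h4 | no big    = badWords-long a u' h4 (≰⇒> big)

ind-not-∧ : ∀ a b → ind (not (a ∧ b)) ≤ ind (not a) + ind (not b)
ind-not-∧ true  b = ≤-refl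
ind-not-∧ false b = s≤s z≤n

ind-not-allB : ∀ {A : Set} (f : A → Bool) xs → ind (not (allB f xs)) ≤ sumL (λ y → ind (not (f y))) xs
ind-not-allB f []       = z≤n
ind-not-allB f (y ∷ ys) = ≤-trans (ind-not-∧ (f y) (allB f ys)) (+-monoʳ-≤ (ind (not (f y))) (ind-not-allB f ys))

ind-not-∨ : ∀ a b → ind (not (not a ∨ b)) ≤ ind a * ind (not b)
ind-not-∨ true  b = ≤-reflexive (sym (+-identityʳ _))
ind-not-∨ false b = z≤n

P1word-fail : ∀ l x → ind (not (P1word l x)) ≤
  sumL (λ n → ind (4 ^ n ≤ᵇ l) * sumL (λ u → violates l n u x) (W n)) (upTo (suc l))
P1word-fail l x = ≤-trans (ind-not-allB _ (upTo (suc l))) (sumL-mono (upTo (suc l)) (λ n →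
  ≤-trans (ind-not-∨ (4 ^ n ≤ᵇ l) _) (*-monoʳ-≤ (ind (4 ^ n ≤ᵇ l)) (ind-not-allB _ (W n)))))

badCount : ℕ → ℕ
badCount l = sumL (λ x → ind (not (P1word l x))) (W l)

badCount≤ : ∀ l → badCount l ≤ sumL (λ n → ind (4 ^ n ≤ᵇ l) * sumL (badWords l n) (W n)) (upTo (suc l))
badCount≤ l = ≤-trans (sumL-mono (W l) (P1word-fail l)) (≤-reflexive (trans
  (sumL-swap (λ x n → ind (4 ^ n ≤ᵇ l) * sumL (λ u → violates l n u x) (W n)) (W l) (upTo (suc l)))
  (sumL-cong (upTo (suc l)) (λ n → trans (sumL-*ˡ (ind (4 ^ n ≤ᵇ l)) (λ x → sumL (λ u → violates l n u x) (W n)) (W l))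
    (cong (ind (4 ^ n ≤ᵇ l) *_) (sumL-swap (λ x u → violates l n u x) (W l) (W n)))))))

module SingleWord (π : Params) where
  open Params π
  open PerPattern π

  -- All patterns of one admitted length n: 2^n · n ≤ 4^n ≤ l of them (weighted).
  perLength : ∀ n → ind (4 ^ n ≤ᵇ l) * sumL (badWords l n) (W n) * 2 ^ X ≤ l * 2 ^ l
  perLength n with 4 ^ n ≤ᵇ l in e
  ... | false = z≤n
  ... | true  = begin
    (sumL (badWords l n) (W n) + 0) * 2 ^ X
      ≡⟨ cong (_* 2 ^ X) (+-identityʳ (sumL (badWords l n) (W n))) ⟩
    sumL (badWords l n) (W n) * 2 ^ X
      ≡⟨ sumL-*ʳ (2 ^ X) (badWords l n) (W n) ⟨
    sumL (λ u → badWords l n u * 2 ^ X) (W n)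
      ≤⟨ sumL-boundᴬ (n * 2 ^ l) (All.map (λ {u} eu → subst (λ k → badWords l k u * 2 ^ X ≤ k * 2 ^ l) eu
                                                         (badWords-bound u (subst (λ k → 4 ^ k ≤ l) (sym eu) h4))) (W-length n)) ⟩
    length (W n) * (n * 2 ^ l)
      ≡⟨ trans (cong (_* (n * 2 ^ l)) (length-W n)) (sym (*-assoc (2 ^ n) n (2 ^ l))) ⟩
    2 ^ n * n * 2 ^ l
      ≤⟨ *-monoˡ-≤ (2 ^ l) (≤-trans (*-monoʳ-≤ (2 ^ n) (<⇒≤ (n<2^n n))) (≤-trans (≤-reflexive (sym (^-distrib-* 2 2 n))) h4)) ⟩
    l * 2 ^ l ∎
    where
    open ≤-Reasoning
    h4 : 4 ^ n ≤ l
    h4 = ≤ᵇ-true e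

  badCount-bound : badCount l * 2 ^ X ≤ suc l * (l * 2 ^ l)
  badCount-bound = begin
    badCount l * 2 ^ X
      ≤⟨ *-monoˡ-≤ (2 ^ X) (badCount≤ l) ⟩
    sumL f (upTo (suc l)) * 2 ^ X
      ≡⟨ sumL-*ʳ (2 ^ X) f (upTo (suc l)) ⟨
    sumL (λ n → f n * 2 ^ X) (upTo (suc l))
      ≤⟨ sumL-bound (l * 2 ^ l) (upTo (suc l)) perLength ⟩
    length (upTo (suc l)) * (l * 2 ^ l)
      ≡⟨ cong (_* (l * 2 ^ l)) (length-upTo (suc l)) ⟩
    suc l * (l * 2 ^ l) ∎
    where
    open ≤-Reasoning
    f : ℕ → ℕ
    f n = ind (4 ^ n ≤ᵇ l) * sumL (badWords l n) (W n)

failCount≡ : ∀ m l → failCount m l ≡ sumL (λ F → ind (not (P1 l F))) (tuples m (W l))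
failCount≡ m l = length-filter (λ F → not (P1 l F)) _ (tuples m (W l))

count-tuples : ∀ {A : Set} m (xs : List A) → length (tuples m xs) ≡ length xs ^ m
count-tuples m xs = trans (sym (trans (sumL-const 1 (tuples m xs)) (*-identityʳ _))) (sumOne m)
  where
  sumOne : ∀ m → sumL (λ _ → 1) (tuples m xs) ≡ length xs ^ m
  sumOne zero    = refl
  sumOne (suc m) = begin
    sumL (λ _ → 1) (concatMap (λ x → map (x ∷_) (tuples m xs)) xs)
      ≡⟨ sumL-concatMap _ _ xs ⟩
    sumL (λ x → sumL (λ _ → 1) (map (x ∷_) (tuples m xs))) xs
      ≡⟨ sumL-cong xs (λ x → trans (sumL-map _ _ (tuples m xs)) (sumOne m)) ⟩
    sumL (λ _ → length xs ^ m) xs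
      ≡⟨ sumL-const _ xs ⟩
    length xs * length xs ^ m ∎
    where open ≡-Reasoning

failCount-bound : ∀ m l → failCount m l * 2 ^ l ≤ m * badCount l * (2 ^ l) ^ m
failCount-bound m l rewrite failCount≡ m l = go m
  where
  B = 2 ^ l
  FC : ℕ → ℕ
  FC m = sumL (λ F → ind (not (P1 l F))) (tuples m (W l))
  -- a family x ∷ F fails iff x fails or F fails
  headOrTail : ∀ m → FC (suc m) ≤ badCount l * B ^ m + B * FC m
  headOrTail m = begin
    FC (suc m)
      ≡⟨ trans (sumL-concatMap _ _ (W l)) (sumL-cong (W l) (λ x → sumL-map _ _ Tm)) ⟩
    sumL (λ x → sumL (λ F → ind (not (P1word l x ∧ P1 l F))) Tm) (W l)
      ≤⟨ sumL-mono (W l) (λ x → sumL-mono Tm (λ F → ind-not-∧ (P1word l x) (P1 l F))) ⟩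
    sumL (λ x → sumL (λ F → ind (not (P1word l x)) + ind (not (P1 l F))) Tm) (W l)
      ≡⟨ trans (sumL-cong (W l) (λ x → sumL-+ _ _ Tm)) (sumL-+ _ _ (W l)) ⟩
    sumL (λ x → sumL (λ _ → ind (not (P1word l x))) Tm) (W l) + sumL (λ _ → FC m) (W l)
      ≡⟨ cong₂ _+_ (trans (sumL-cong (W l) (λ x → trans (sumL-const _ Tm) (*-comm _ (ind (not (P1word l x))))))
                          (sumL-*ʳ (length Tm) _ (W l)))
                   (trans (sumL-const _ (W l)) (cong (_* FC m) (length-W l))) ⟩
    badCount l * length Tm + B * FC m
      ≡⟨ cong (λ z → badCount l * z + B * FC m) (trans (count-tuples m (W l)) (cong (_^ m) (length-W l))) ⟩
    badCount l * B ^ m + B * FC m ∎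
    where
    open ≤-Reasoning
    Tm = tuples m (W l)
  go : ∀ m → FC m * B ≤ m * badCount l * B ^ m
  go zero    = z≤n
  go (suc m) = begin
    FC (suc m) * B
      ≤⟨ *-monoˡ-≤ B (headOrTail m) ⟩
    (b * B ^ m + B * FC m) * B
      ≡⟨ solve 4 (λ b B Bm f → (b :* Bm :+ B :* f) :* B := b :* (B :* Bm) :+ B :* (f :* B)) refl b B (B ^ m) (FC m) ⟩
    b * (B * B ^ m) + B * (FC m * B)
      ≤⟨ +-monoʳ-≤ (b * (B * B ^ m)) (*-monoʳ-≤ B (go m)) ⟩
    b * (B * B ^ m) + B * (m * b * B ^ m)
      ≡⟨ solve 4 (λ b B Bm m → b :* (B :* Bm) :+ B :* (m :* b :* Bm) := (con 1 :+ m) :* b :* (B :* Bm)) refl b B (B ^ m) m ⟩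
    suc m * b * (B * B ^ m) ∎
    where
    open ≤-Reasoning
    b = badCount l

-- A family of 2^p words, each failing (P1) with probability ≤ (l+1)·l·2^(-X)
-- ≤ 2^(2(L+1) - X), fails with probability ≤ 2^(p + 2(L+1) - X).
familyBound : ∀ (π : Params) p → let open Params π in
  failCount (2 ^ p) l * 2 ^ X ≤ 2 ^ (p + 2 * suc L) * 2 ^ (l * 2 ^ p)
familyBound π p = *-cancelʳ-≤ _ _ B {{m^n≢0 2 l}} (begin
  F * 2 ^ X * B                  ≡⟨ solve 3 (λ f x b → f :* x :* b := f :* b :* x) refl F (2 ^ X) B ⟩
  F * B * 2 ^ X                  ≤⟨ *-monoˡ-≤ (2 ^ X) (failCount-bound (2 ^ p) l) ⟩
  2 ^ p * badCount l * Ω * 2 ^ X ≡⟨ solve 4 (λ a b t x → a :* b :* t :* x := a :* (b :* x) :* t) refl (2 ^ p) (badCount l) Ω (2 ^ X) ⟩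
  2 ^ p * (badCount l * 2 ^ X) * Ω ≤⟨ *-monoˡ-≤ Ω (*-monoʳ-≤ (2 ^ p) (badCount-bound π)) ⟩
  2 ^ p * (suc l * (l * B)) * Ω  ≡⟨ solve 5 (λ a m l b t → a :* (m :* (l :* b)) :* t := a :* (m :* l) :* t :* b) refl (2 ^ p) (suc l) l B Ω ⟩
  2 ^ p * (suc l * l) * Ω * B    ≤⟨ *-monoˡ-≤ B (*-monoˡ-≤ Ω (*-monoʳ-≤ (2 ^ p) (*-mono-≤ hlL (<⇒≤ hlL)))) ⟩
  2 ^ p * (2 ^ suc L * 2 ^ suc L) * Ω * B
    ≡⟨ cong (λ z → z * Ω * B) (trans (cong (2 ^ p *_) doubleExp) (sym (^-distribˡ-+-* 2 p _))) ⟩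
  2 ^ (p + 2 * suc L) * Ω * B    ≡⟨ cong (λ z → 2 ^ (p + 2 * suc L) * z * B) (^-*-assoc 2 l (2 ^ p)) ⟩
  2 ^ (p + 2 * suc L) * 2 ^ (l * 2 ^ p) * B ∎)
  where
  open Params π
  open SingleWord using (badCount-bound)
  open ≤-Reasoning
  B = 2 ^ l
  Ω = B ^ (2 ^ p)
  F = failCount (2 ^ p) l
  doubleExp : 2 ^ suc L * 2 ^ suc L ≡ 2 ^ (2 * suc L)
  doubleExp = sym (trans (cong (λ k → 2 ^ (suc L + k)) (+-identityʳ (suc L))) (^-distribˡ-+-* 2 (suc L) (suc L)))

powerForm : ∀ b F G Ω X Y Z → F * 2 ^ X ≤ 2 ^ Y * Ω → G ≤ 2 ^ Z → Z + b * Y ≤ b * X → F ^ b * G ≤ Ω ^ b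
powerForm b F G Ω X Y Z hF hG hZ = *-cancelʳ-≤ _ _ ((2 ^ Y) ^ b) {{m^n≢0 (2 ^ Y) b {{m^n≢0 2 Y}}}} (begin
  F ^ b * G * (2 ^ Y) ^ b        ≤⟨ *-monoˡ-≤ ((2 ^ Y) ^ b) (*-monoʳ-≤ (F ^ b) hG) ⟩
  F ^ b * 2 ^ Z * (2 ^ Y) ^ b    ≡⟨ trans (*-assoc (F ^ b) _ _) (cong (λ k → F ^ b * (2 ^ Z * k)) (trans (^-*-assoc 2 Y b) (cong (2 ^_) (*-comm Y b)))) ⟩
  F ^ b * (2 ^ Z * 2 ^ (b * Y))  ≡⟨ cong (F ^ b *_) (^-distribˡ-+-* 2 Z (b * Y)) ⟨
  F ^ b * 2 ^ (Z + b * Y)        ≤⟨ *-monoʳ-≤ (F ^ b) (^-monoʳ-≤ 2 hZ) ⟩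
  F ^ b * 2 ^ (b * X)            ≡⟨ cong (F ^ b *_) (trans (cong (2 ^_) (*-comm b X)) (sym (^-*-assoc 2 X b))) ⟩
  F ^ b * (2 ^ X) ^ b            ≡⟨ ^-distrib-* F (2 ^ X) b ⟨
  (F * 2 ^ X) ^ b                ≤⟨ ^-monoˡ-≤ b hF ⟩
  (2 ^ Y * Ω) ^ b                ≡⟨ trans (^-distrib-* (2 ^ Y) Ω b) (*-comm _ (Ω ^ b)) ⟩
  Ω ^ b * (2 ^ Y) ^ b            ∎)
  where open ≤-Reasoning

half-lo : ∀ n → 2 * ⌊ n /2⌋ ≤ n
half-lo n = ≤-trans (≤-reflexive (cong (⌊ n /2⌋ +_) (+-identityʳ _)))
  (≤-trans (+-monoʳ-≤ ⌊ n /2⌋ (⌊n/2⌋≤⌈n/2⌉ n)) (≤-reflexive (⌊n/2⌋+⌈n/2⌉≡n n)))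

half-hi : ∀ n → n ≤ suc (2 * ⌊ n /2⌋)
half-hi zero          = z≤n
half-hi (suc zero)    = s≤s z≤n
half-hi (suc (suc n)) = ≤-trans (s≤s (s≤s (half-hi n)))
  (≤-reflexive (cong suc (solve 1 (λ h → con 2 :+ con 2 :* h := con 2 :* (con 1 :+ h)) refl ⌊ n /2⌋)))

-- Induction on n via n ↦ ⌊n/2⌋, with an explicit bound k ≥ n for termination.
log-lo′ : ∀ k n → n ≤ k → 1 ≤ n → 2 ^ ⌊log₂ n ⌋ ≤ n
log-lo′ k             (suc zero)    _  _ = ≤-refl
log-lo′ (suc k)       (suc (suc n)) n≤k _ = begin
  2 ^ ⌊log₂ m ⌋          ≡⟨ cong (2 ^_) (trans eL (cong suc (sym (⌊log₂⌊n/2⌋⌋≡⌊log₂n⌋∸1 m)))) ⟩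
  2 * 2 ^ ⌊log₂ half ⌋   ≤⟨ *-monoʳ-≤ 2 (log-lo′ k half (≤-pred (≤-trans (⌊n/2⌋<n (suc n)) n≤k)) (s≤s z≤n)) ⟩
  2 * half               ≤⟨ half-lo m ⟩
  m                      ∎
  where
  open ≤-Reasoning
  m = suc (suc n)
  half = ⌊ m /2⌋
  eL : ⌊log₂ m ⌋ ≡ suc (⌊log₂ m ⌋ ∸ 1)
  eL = sym (trans (+-comm 1 _) (m∸n+n≡m (⌊log₂⌋-mono-≤ {2} {m} (s≤s (s≤s z≤n)))))

log-lo : ∀ n → 1 ≤ n → 2 ^ ⌊log₂ n ⌋ ≤ n
log-lo n = log-lo′ n n ≤-refl

log-hi : ∀ n → n < 2 ^ suc ⌊log₂ n ⌋
log-hi n = ≰⇒> (λ h → 1+n≰n (≤-trans (≤-reflexive (sym (⌊log₂[2^n]⌋≡n (suc ⌊log₂ n ⌋)))) (⌊log₂⌋-mono-≤ h)))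

log-ge : ∀ k n → 2 ^ k ≤ n → k ≤ ⌊log₂ n ⌋
log-ge k n h = ≤-trans (≤-reflexive (sym (⌊log₂[2^n]⌋≡n k))) (⌊log₂⌋-mono-≤ h)

linear≤exp : ∀ h → 4 ≤ h → 2 * h + 3 ≤ 2 ^ h
linear≤exp h 4≤h with m≤n⇒∃[o]m+o≡n 4≤h
... | d , refl = go d
  where
  go : ∀ d → 2 * (4 + d) + 3 ≤ 2 ^ (4 + d)
  go zero    = ≤ᵇ⇒≤ 11 16 tt
  go (suc d) = begin
    2 * (5 + d) + 3       ≡⟨ solve 1 (λ d → con 2 :* (con 5 :+ d) :+ con 3 := con 2 :* (con 4 :+ d) :+ con 3 :+ con 2) refl d ⟩
    2 * (4 + d) + 3 + 2   ≤⟨ +-mono-≤ (go d) (^-monoʳ-≤ 2 {1} {4 + d} (s≤s z≤n)) ⟩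
    2 ^ (4 + d) + 2 ^ (4 + d) ≡⟨ cong (2 ^ (4 + d) +_) (sym (+-identityʳ _)) ⟩
    2 ^ (5 + d)           ∎
    where open ≤-Reasoning

-- The exponent budget: with J ≥ 24, L + 2 ≤ 2w' and s, p ≤ 4w' the losses
-- (J+4)s (from L^s), 8(p + 2(L+1)) (union bounds) and 8(J+2) fit into 8w'J.
exponent-budget : ∀ J L w' s p → 24 ≤ J → J ≤ L → L + 2 ≤ 2 * w' → s ≤ 4 * w' → p ≤ 4 * w' →
  (J + 4) * s + 8 * (p + 2 * suc L) + 8 * (J + 2) ≤ 8 * (w' * J)
exponent-budget J L w' s p h24 J≤L hw hs hp = begin
  (J + 4) * s + 8 * (p + 2 * suc L) + 8 * (J + 2)
    ≤⟨ +-monoˡ-≤ (8 * (J + 2)) (+-mono-≤ (*-monoʳ-≤ (J + 4) hs) (*-monoʳ-≤ 8 (+-monoˡ-≤ (2 * suc L) hp))) ⟩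
  (J + 4) * (4 * w') + 8 * (4 * w' + 2 * suc L) + 8 * (J + 2)
    ≡⟨ solve 3 (λ J L w → (J :+ con 4) :* (con 4 :* w) :+ con 8 :* (con 4 :* w :+ con 2 :* (con 1 :+ L)) :+ con 8 :* (J :+ con 2)
                := con 4 :* w :* J :+ con 48 :* w :+ (con 16 :* L :+ con 8 :* J :+ con 32)) refl J L w' ⟩
  4 * w' * J + 48 * w' + (16 * L + 8 * J + 32)
    ≤⟨ +-monoʳ-≤ (4 * w' * J + 48 * w') (+-monoˡ-≤ 32 (+-monoʳ-≤ (16 * L) (*-monoʳ-≤ 8 J≤L))) ⟩
  4 * w' * J + 48 * w' + (16 * L + 8 * L + 32)
    ≤⟨ +-monoʳ-≤ (4 * w' * J + 48 * w') (+-monoʳ-≤ (16 * L + 8 * L) (m≤m+n 32 16)) ⟩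
  4 * w' * J + 48 * w' + (16 * L + 8 * L + (32 + 16))
    ≡⟨ cong (4 * w' * J + 48 * w' +_) (solve 1 (λ L → con 16 :* L :+ con 8 :* L :+ (con 32 :+ con 16) := con 24 :* (L :+ con 2)) refl L) ⟩
  4 * w' * J + 48 * w' + 24 * (L + 2)
    ≤⟨ +-monoʳ-≤ (4 * w' * J + 48 * w') (*-monoʳ-≤ 24 hw) ⟩
  4 * w' * J + 48 * w' + 24 * (2 * w')
    ≡⟨ solve 2 (λ w j → con 4 :* w :* j :+ con 48 :* w :+ con 24 :* (con 2 :* w) := con 4 :* w :* j :+ con 4 :* w :* con 24) refl w' J ⟩
  4 * w' * J + 4 * w' * 24
    ≤⟨ +-monoʳ-≤ (4 * w' * J) (*-monoʳ-≤ (4 * w') h24) ⟩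
  4 * w' * J + 4 * w' * J
    ≡⟨ solve 2 (λ w j → con 4 :* w :* j :+ con 4 :* w :* j := con 8 :* (w :* j)) refl w' J ⟩
  8 * (w' * J) ∎
  where open ≤-Reasoning

-- The parameters for a given large l:  L = ⌊log l⌋,  J = ⌊log L⌋ - 3,
-- h = ⌊L/2⌋,  w = 2w' = 2^h ≈ √l,  X = w'J - (J + 2) ≈ √l · log log l / 2.
module Choice (l : ℕ) (l-large : 2 ^ (2 ^ 27) ≤ l) where
  L logL J h w' X : ℕ
  L    = ⌊log₂ l ⌋
  logL = ⌊log₂ L ⌋
  J    = logL ∸ 3
  h    = ⌊ L /2⌋
  w'   = 2 ^ (h ∸ 1)
  X    = w' * J ∸ (J + 2)

  l≥1 : 1 ≤ l
  l≥1 = ≤-trans (m^n>0 2 (2 ^ 27)) l-large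

  L-large : 2 ^ 27 ≤ L
  L-large = log-ge (2 ^ 27) l l-large

  logL≥27 : 27 ≤ logL
  logL≥27 = log-ge 27 L L-large

  2^L≤l : 2 ^ L ≤ l
  2^L≤l = log-lo l l≥1

  2^logL≤L : 2 ^ logL ≤ L
  2^logL≤L = log-lo L (≤-trans (m^n>0 2 27) L-large)

  logL≡J+3 : logL ≡ J + 3
  logL≡J+3 = sym (m∸n+n≡m (≤-trans (≤ᵇ⇒≤ 3 27 tt) logL≥27))

  J≥24 : 24 ≤ J
  J≥24 = ∸-monoˡ-≤ 3 logL≥27

  logL≤L : logL ≤ L
  logL≤L = <⇒≤ (<-≤-trans (n<2^n logL) 2^logL≤L)

  J≤L : J ≤ L
  J≤L = ≤-trans (m∸n≤m logL 3) logL≤L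

  8·2^J≤L : 8 * 2 ^ J ≤ L
  8·2^J≤L = ≤-trans (≤-reflexive (trans (*-comm 8 (2 ^ J))
    (trans (sym (^-distribˡ-+-* 2 J 3)) (cong (2 ^_) (sym logL≡J+3))))) 2^logL≤L

  L≤2h+1 : L ≤ suc (2 * h)
  L≤2h+1 = half-hi L

  -- 27 ≤ L ≤ 2h + 1
  h≥4 : 4 ≤ h
  h≥4 = ≮⇒≥ (λ h<4 → <⇒≱ (≤ᵇ⇒≤ 8 27 tt)
    (≤-trans (≤-trans logL≥27 logL≤L) (≤-trans L≤2h+1 (s≤s (*-monoʳ-≤ 2 (≤-pred h<4))))))

  2w'≡2^h : 2 * w' ≡ 2 ^ h
  2w'≡2^h = cong (2 ^_) (trans (+-comm 1 (h ∸ 1)) (m∸n+n≡m (≤-trans (s≤s z≤n) h≥4)))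

  -- X is chosen so that 2(X + J + 2) = wJ exactly.
  X+J+2≡w'J : X + (J + 2) ≡ w' * J
  X+J+2≡w'J = m∸n+n≡m (≤-trans (+-monoʳ-≤ J (≤-trans (≤ᵇ⇒≤ 2 24 tt) J≥24))
    (≤-trans (≤-reflexive (solve 1 (λ j → j :+ j := con 2 :* j) refl J))
             (*-monoˡ-≤ J (^-monoʳ-≤ 2 {1} {h ∸ 1} (∸-monoˡ-≤ 1 (≤-trans (s≤s (s≤s z≤n)) h≥4))))))

  params : Params
  params = record
    { l = l ; L = L ; J = J ; w = 2 * w' ; X = X
    ; l≥1 = l≥1
    ; J≥1 = ≤-trans (≤ᵇ⇒≤ 1 24 tt) J≥24
    ; hl  = ≤-trans (≤-reflexive (trans (cong (2 ^_) (*-comm l L)) (sym (^-*-assoc 2 L l)))) (^-monoˡ-≤ l 2^L≤l)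
    ; hlL = log-hi l
    ; hJL = 8·2^J≤L
    ; hw  = ≤-trans (≤-reflexive (trans (cong₂ _*_ 2w'≡2^h 2w'≡2^h) (sym (^-distribˡ-+-* 2 h h))))
             (≤-trans (^-monoʳ-≤ 2 (≤-trans (≤-reflexive (cong (h +_) (sym (+-identityʳ h)))) (half-lo L))) 2^L≤l)
    ; hX  = ≤-reflexive (trans (cong (2 *_) (trans (+-assoc X J 2) X+J+2≡w'J)) (sym (*-assoc 2 w' J)))
    }

  -- Every a with a² ≤ l satisfies a ≤ 4w' (as l < 2^(L+1) ≤ (4w')²).
  sqrt-bound : ∀ a → a * a ≤ l → a ≤ 4 * w'
  sqrt-bound a ha = <⇒≤ (sq-cancel-< a (4 * w') (<-≤-trans (≤-<-trans ha (log-hi l)) (begin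
    2 ^ suc L              ≤⟨ ^-monoʳ-≤ 2 (≤-trans (s≤s L≤2h+1) (≤-reflexive (solve 1 (λ h → con 2 :+ con 2 :* h := (con 1 :+ h) :+ (con 1 :+ h)) refl h))) ⟩
    2 ^ (suc h + suc h)    ≡⟨ ^-distribˡ-+-* 2 (suc h) (suc h) ⟩
    2 ^ suc h * 2 ^ suc h  ≡⟨ cong₂ _*_ 4w' 4w' ⟩
    4 * w' * (4 * w')      ∎)))
    where
    open ≤-Reasoning
    4w' : 2 ^ suc h ≡ 4 * w'
    4w' = trans (cong (2 *_) (sym 2w'≡2^h)) (sym (*-assoc 2 2 w'))

  -- L + 2 ≤ 2h + 3 ≤ 2^h = 2w'.
  L+2≤2w' : L + 2 ≤ 2 * w'
  L+2≤2w' = ≤-trans (≤-trans (+-monoˡ-≤ 2 L≤2h+1) (≤-reflexive (solve 1 (λ h → con 1 :+ con 2 :* h :+ con 2 := con 2 :* h :+ con 3) refl h)))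
    (≤-trans (linear≤exp h h≥4) (≤-reflexive (sym 2w'≡2^h)))

  -- L^s ≤ 2^((J+4)s) since L < 2^(logL+1) = 2^(J+4).
  logPower : ∀ s → L ^ (1 * s) ≤ 2 ^ ((J + 4) * s)
  logPower s = begin
    L ^ (1 * s)         ≡⟨ cong (L ^_) (*-identityˡ s) ⟩
    L ^ s               ≤⟨ ^-monoˡ-≤ s (<⇒≤ (log-hi L)) ⟩
    (2 ^ suc logL) ^ s  ≡⟨ ^-*-assoc 2 (suc logL) s ⟩
    2 ^ (suc logL * s)  ≡⟨ cong (λ k → 2 ^ (k * s)) (trans (cong suc logL≡J+3) (sym (+-suc J 3))) ⟩
    2 ^ ((J + 4) * s)   ∎
    where open ≤-Reasoning

  budget : ∀ s p → s * s ≤ l → p * p ≤ l → (J + 4) * s + 8 * (p + 2 * suc L) ≤ 8 * X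
  budget s p hs hp = +-cancelʳ-≤ (8 * (J + 2)) _ _
    (≤-trans (exponent-budget J L w' s p J≥24 J≤L L+2≤2w' (sqrt-bound s hs) (sqrt-bound p hp))
             (≤-reflexive (trans (cong (8 *_) (sym X+J+2≡w'J)) (*-distribˡ-+ 8 X (J + 2)))))

-- Main theorem: for l ≥ 2^(2^27), p² ≤ l and s² ≤ l,
--   Pr[F fails (P1)]^8 · (log l)^s ≤ 1,
-- i.e. Pr ≤ 2^(-(1/8)·√l·log log l) in the floored form of the statement.
mainTheorem9 : ∃[ a ] ∃[ b ] ∃[ L₀ ] (1 ≤ a × 1 ≤ b ×
    (∀ (l p s : ℕ) → L₀ ≤ l → 1 ≤ p → p * p ≤ l → s * s ≤ l →
    failCount (2 ^ p) l ^ b * ⌊log₂ l ⌋ ^ (a * s)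
    ≤ (2 ^ (l * 2 ^ p)) ^ b))
mainTheorem9 = 1 , 8 , 2 ^ (2 ^ 27) , ≤-refl , s≤s z≤n , bound
  where
  bound : ∀ l p s → 2 ^ (2 ^ 27) ≤ l → 1 ≤ p → p * p ≤ l → s * s ≤ l →
    failCount (2 ^ p) l ^ 8 * ⌊log₂ l ⌋ ^ (1 * s) ≤ (2 ^ (l * 2 ^ p)) ^ 8
  bound l p s l-large _ hp hs =
    powerForm 8 (failCount (2 ^ p) l) (L ^ (1 * s)) (2 ^ (l * 2 ^ p)) X (p + 2 * suc L) ((J + 4) * s)
      (familyBound params p) (logPower s) (budget s p hs hp)
    where open Choice l l-large
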